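{- Let $(G=(V,E),L,c,r,e_r)$ be a rooted WRAP instance and $\vec F\subseteq\mathrm{Shadows}(L)$ a non-shortenable directed WRAP solution. A directed link $(u,v)\in\vec F$ is responsible for a 2-cut $C\in\mathcal C_G$ if and only if $v\in C$ and all vertices of $C$ are $v$-bad.
   Context: Rooted WRAP instance: cycle $G=(V,E)$, links $L\subseteq\binom V2$, costs $c$, root $r$, edge $e_r\in E$ at $r$. $\mathcal C_G=\{C\subseteq V\setminus\{r\}:|\delta_E(C)|=2\}$. Directed link $(u,v)$ covers $C$ if $v\in C,u\notin C$; directed WRAP solution covers all $C\in\mathcal C_G$. Shortening of $(u,v)$: $(s,v)$, $s\ne v$, $s$ on the $u$-$v$ path of $(V,E\setminus\{e_r\})$ (strict if $s\ne u$); shadows of $\{u,v\}$: shortenings of $(u,v)$ or $(v,u)$. Non-shortenable: deleting or strictly shortening any link destroys feasibility; then $(V,\vec F)$ is an $r$-arborescence. $(u,v)\in\vec F$ is responsible for $C$ if it covers $C$ and no link on the $r$-$u$ path in $(V,\vec F)$ covers $C$. A vertex $w$ is $v$-bad if it is a descendant of $v$ in $(V,\vec F)$ ($v$ itself is $v$-bad), and $v$-good otherwise. -}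

module Defs where

open import Data.Nat using (ℕ; zero; suc; _≤_; _<_) renaming (_<?_ to _<ℕ?_)
open import Data.Fin using (Fin; zero; suc; toℕ; fromℕ<; _≟_)
open import Data.Bool using (Bool; true; false; if_then_else_; _xor_; _∧_)
open import Data.List using (List; map; allFin)
open import Data.Nat.ListAction using (sum)
open import Data.Empty using (⊥)
open import Data.Product using (Σ; ∃; _×_; _,_)
open import Data.Sum using (_⊎_)
open import Relation.Nullary using (¬_; yes; no; does)
open import Relation.Binary.PropositionalEquality using (_≡_; _≢_)

-- Convention: the cycle G has vertex set Fin n (n ≥ 3),
-- vertices numbered along the cycle so that the root is r = 0 and the
-- root edge is e_r = {n-1, 0}.  Hence the path (V, E ∖ {e_r}) is
-- 0 - 1 - ... - (n-1).  Edges of G: {i, next i} for i : Fin n.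

next : ∀ {n} → Fin n → Fin n
next {suc m} i with suc (toℕ i) <ℕ? suc m
... | yes p = fromℕ< p
... | no _  = zero


VSet : ℕ → Set
VSet n = Fin n → Bool

cutSize : ∀ {n} → VSet n → ℕ
cutSize {n} C = sum (map (λ i → if C i xor C (next i) then 1 else 0) (allFin n))

Is2Cut : ∀ {n} → (r : Fin n) → VSet n → Set
Is2Cut r C = (C r ≡ false) × (cutSize C ≡ 2)

-- s lies on the u-v path of (V, E ∖ {e_r}) = 0 - 1 - ... - (n-1)
OnPath : ∀ {n} → Fin n → Fin n → Fin n → Set
OnPath u v s = (toℕ u ≤ toℕ s × toℕ s ≤ toℕ v) ⊎ (toℕ v ≤ toℕ s × toℕ s ≤ toℕ u)

-- a set of links L ⊆ (V choose 2): L u v means {u,v} ∈ L (read symmetrically)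
LinkSet : ℕ → Set
LinkSet n = Fin n → Fin n → Bool

InL : ∀ {n} → LinkSet n → Fin n → Fin n → Set
InL L u v = (L u v ≡ true) ⊎ (L v u ≡ true)

Shortening : ∀ {n} → (u v s : Fin n) → Set
Shortening u v s = (s ≢ v) × OnPath u v s

StrictShortening : ∀ {n} → (u v s : Fin n) → Set
StrictShortening u v s = Shortening u v s × (s ≢ u)

-- (s,t) ∈ Shadows(L): a shortening of (x,t) for some {x,t} ∈ L
-- (this covers shortenings of both orientations of every link)
Shadow : ∀ {n} → LinkSet n → Fin n → Fin n → Set
Shadow L s t = ∃ λ x → InL L x t × Shortening x t s

DLinkSet : ℕ → Set
DLinkSet n = Fin n → Fin n → Bool

_∈F_ : ∀ {n} → Fin n × Fin n → DLinkSet n → Set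
(a , b) ∈F F = F a b ≡ true

remove : ∀ {n} → DLinkSet n → Fin n → Fin n → DLinkSet n
remove F u v a b = if does (a ≟ u) ∧ does (b ≟ v) then false else F a b

add : ∀ {n} → DLinkSet n → Fin n → Fin n → DLinkSet n
add F s v a b = if does (a ≟ s) ∧ does (b ≟ v) then true else F a b

Covers : ∀ {n} → Fin n → Fin n → VSet n → Set
Covers u v C = (C v ≡ true) × (C u ≡ false)

Feasible : ∀ {n} → Fin n → DLinkSet n → Set
Feasible {n} r F = (C : VSet n) → Is2Cut r C →
  ∃ λ a → ∃ λ b → ((a , b) ∈F F) × Covers a b C

NonShortenable : ∀ {n} → Fin n → DLinkSet n → Set
NonShortenable r F =
  Feasible r F ×
  (∀ u v → (u , v) ∈F F →
     ¬ Feasible r (remove F u v) ×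
     (∀ s → StrictShortening u v s → ¬ Feasible r (add (remove F u v) s v)))

data Walk {n} (F : DLinkSet n) : Fin n → Fin n → Set where
  [] : ∀ {x} → Walk F x x
  _∷_ : ∀ {x y z} → (x , y) ∈F F → Walk F y z → Walk F x z

LinkOn : ∀ {n} {F : DLinkSet n} {x y} → Fin n → Fin n → Walk F x y → Set
LinkOn a b [] = ⊥
LinkOn {x = x} a b (_∷_ {y = y} _ w) = ((a ≡ x) × (b ≡ y)) ⊎ LinkOn a b w

Responsible : ∀ {n} → Fin n → DLinkSet n → Fin n → Fin n → VSet n → Set
Responsible r F u v C =
  Covers u v C ×
  ((p : Walk F r u) → ∀ a b → LinkOn a b p → ¬ Covers a b C)

Bad : ∀ {n} → DLinkSet n → Fin n → Fin n → Set
Bad F v w = Walk F v w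

module Submission where

-- Number the cycle 0, 1, …, m along the path that avoids the root edge, with
-- the root at 0.  The 2-cuts not containing the root are then exactly the
-- intervals [i, j] with 1 ≤ i ≤ j ≤ m.  Non-shortenability gives every link
-- (u, v) a window: an interval containing v and everything strictly between
-- u and v but not u, which (u, v) is the only link of F to enter.  Two such
-- windows never cross, so every vertex has at most one incoming link, and
-- if (a, b) is the sole entry of an interval then each side of the interval
-- beyond b is entered only from b; descending, every vertex of the interval
-- lies below b.  Applied to the window [1, m] of the root, (V, F) is an
-- arborescence rooted at 0.
--
-- If all of C lies below v, a link covering C on a root–u path would close
-- a cycle through (u, v).  Conversely, if w ∈ C is not below v, the descent
-- yields a vertex z of C between v and w with v below z; the root path to
-- z, continued to u, covers C before (u, v) does.

open import Defs
open import Data.Nat using (ℕ; zero; suc; pred; _⊓_; _⊔_; _+_; _≤_; _<_; _>_; z≤n; s≤s)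
open import Data.Nat.Properties hiding (_≟_)
open import Data.Fin using (Fin; zero; suc; toℕ; fromℕ<; _≟_)
open import Data.Fin.Properties using (any?; toℕ-injective; toℕ≤pred[n]; fromℕ<-toℕ; toℕ-fromℕ<)
open import Data.Bool using (Bool; true; false; if_then_else_; _xor_)
open import Data.List using (tabulate)
open import Data.List.Properties using (map-tabulate)
open import Data.Nat.ListAction using (sum)
open import Data.Empty using (⊥; ⊥-elim)
open import Data.Product using (∃; ∃₂; _×_; _,_; proj₁; proj₂; map₂)
open import Data.Sum using (_⊎_; inj₁; inj₂)
import Data.Sum
open import Relation.Binary using (Tri; tri<; tri≈; tri>)
open import Function using (_∘_; id)
open import Function.Bundles using (_⇔_; mk⇔; Equivalence)
open import Relation.Nullary using (¬_; Dec; yes; no; contradiction)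
open import Relation.Nullary.Decidable using (⌊_⌋; _×-dec_; ¬?; toWitness; fromWitness; decidable-stable)
open import Data.Bool.Properties using (T-≡; ¬-not) renaming (_≟_ to _≟ᵇ_)
open import Relation.Binary.PropositionalEquality
  using (_≡_; _≢_; refl; sym; trans; cong; cong₂; subst; subst₂; module ≡-Reasoning)

open Equivalence using (to; from)

χ : Bool → ℕ
χ b = if b then 1 else 0

sumBelow : (ℕ → ℕ) → ℕ → ℕ
sumBelow G zero = 0
sumBelow G (suc l) = sumBelow G l + G l

sumBelow-suc : ∀ G l → sumBelow G (suc l) ≡ G 0 + sumBelow (G ∘ suc) l
sumBelow-suc G zero = +-comm 0 (G 0)
sumBelow-suc G (suc l) =
  trans (cong (_+ G (suc l)) (sumBelow-suc G l)) (+-assoc (G 0) _ _)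

sumBelow-cong : ∀ {G H} l → (∀ k → k < l → G k ≡ H k) → sumBelow G l ≡ sumBelow H l
sumBelow-cong zero eq = refl
sumBelow-cong (suc l) eq =
  cong₂ _+_ (sumBelow-cong l (λ k k<l → eq k (m<n⇒m<1+n k<l))) (eq l ≤-refl)

sum-tabulate : ∀ n (g : Fin n → ℕ) G → (∀ i → g i ≡ G (toℕ i)) →
  sum (tabulate g) ≡ sumBelow G n
sum-tabulate zero g G eq = refl
sum-tabulate (suc n) g G eq =
  trans (cong₂ _+_ (eq zero) (sum-tabulate n (g ∘ suc) (G ∘ suc) (eq ∘ suc)))
        (sym (sumBelow-suc G n))

false⇔ : ∀ {b} {P : Set} → b ≡ false → ¬ P → b ≡ true ⇔ P
false⇔ refl ¬p = mk⇔ (λ ()) (⊥-elim ∘ ¬p)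

true⇔ : ∀ {b} {P : Set} → b ≡ true → P → b ≡ true ⇔ P
true⇔ refl p = mk⇔ (λ _ → p) (λ _ → refl)

false⇒¬ : ∀ {b} {P : Set} → b ≡ true ⇔ P → b ≡ false → ¬ P
false⇒¬ b⇔P refl p with from b⇔P p
... | ()

¬⇒false : ∀ {b} {P : Set} → b ≡ true ⇔ P → ¬ P → b ≡ false
¬⇒false b⇔P ¬p = ¬-not (¬p ∘ to b⇔P)


module Transitions (c : ℕ → Bool) where

  changes : ℕ → ℕ
  changes = sumBelow (λ k → χ (c k xor c (suc k)))

  Represents : ℕ → (ℕ → Set) → Set
  Represents l P = ∀ k → k ≤ l → c k ≡ true ⇔ P k

  Convex : ℕ → Set
  Convex l = ∀ {k₁ k₂ k₃} → k₁ ≤ k₂ → k₂ ≤ k₃ → k₃ ≤ l →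
    c k₁ ≡ true → c k₃ ≡ true → c k₂ ≡ true

  data Shape (l : ℕ) : ℕ → Set where
    none   : Represents l (λ _ → ⊥) → Shape l 0
    suffix : ∀ {i} → 1 ≤ i → i ≤ l → Represents l (i ≤_) → Shape l 1
    block  : ∀ {i j} → 1 ≤ i → i ≤ j → j < l →
             Represents l (λ k → i ≤ k × k ≤ j) → Shape l 2
    gapped : ∀ {t} → 3 ≤ t → ¬ Convex l → Shape l t

  Convex-pred : ∀ {l} → Convex (suc l) → Convex l
  Convex-pred convex k₁≤k₂ k₂≤k₃ k₃≤l = convex k₁≤k₂ k₂≤k₃ (m≤n⇒m≤1+n k₃≤l)

  extend : ∀ {l P} → Represents l P → c (suc l) ≡ true ⇔ P (suc l) → Represents (suc l) P
  extend h e k k≤ with m≤n⇒m<n∨m≡n k≤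
  ... | inj₁ k<sl = h k (≤-pred k<sl)
  ... | inj₂ refl = e

  reread : ∀ {l P Q} → Represents l P → (∀ k → k ≤ l → P k ⇔ Q k) → Represents l Q
  reread h pq k k≤ = mk⇔ (to (pq k k≤) ∘ to (h k k≤)) (from (h k k≤) ∘ from (pq k k≤))

  bit-false : ∀ {l P} → Represents l P → ¬ P l → c l ≡ false
  bit-false {l} h ¬p with c l in e
  ... | true = ⊥-elim (¬p (to (h l ≤-refl) e))
  ... | false = refl

  bit-true : ∀ {l P} → Represents l P → P l → c l ≡ true
  bit-true h p = from (h _ ≤-refl) p

  changes-step : ∀ {l t b} b′ → changes l ≡ t → c l ≡ b →
    changes l + χ (c l xor b′) ≡ t + χ (b xor b′)
  changes-step b′ eq p = cong₂ _+_ eq (cong (λ x → χ (x xor b′)) p)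

  shape : c 0 ≡ false → ∀ l → ∃₂ λ t (s : Shape l t) → changes l ≡ t
  shape c0 zero = 0 , none (λ { zero _ → false⇔ c0 id }) , refl
  shape c0 (suc l) with shape c0 l | c (suc l) in e
  ... | _ , none h , eq | false =
    0 , none (extend h (false⇔ e id)) , changes-step _ eq (bit-false h id)
  ... | _ , none h , eq | true =
    1 , suffix (s≤s z≤n) ≤-refl
          (extend (reread h λ k k≤ → mk⇔ ⊥-elim (<⇒≱ (s≤s k≤))) (true⇔ e ≤-refl)) ,
    changes-step _ eq (bit-false h id)
  ... | _ , suffix 1≤i i≤l h , eq | true =
    1 , suffix 1≤i (m≤n⇒m≤1+n i≤l) (extend h (true⇔ e (m≤n⇒m≤1+n i≤l))) ,
    changes-step _ eq (bit-true h i≤l)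
  ... | _ , suffix 1≤i i≤l h , eq | false =
    2 , block 1≤i i≤l ≤-refl
          (extend (reread h λ k k≤ → mk⇔ (_, k≤) proj₁) (false⇔ e (1+n≰n ∘ proj₂))) ,
    changes-step _ eq (bit-true h i≤l)
  ... | _ , block 1≤i i≤j j<l h , eq | false =
    2 , block 1≤i i≤j (m<n⇒m<1+n j<l)
          (extend h (false⇔ e (<⇒≱ j<l ∘ <⇒≤ ∘ proj₂))) ,
    changes-step _ eq (bit-false h (<⇒≱ j<l ∘ proj₂))
  ... | _ , block {i} {j} 1≤i i≤j j<l h , eq | true =
    3 , gapped ≤-refl gap , changes-step _ eq (bit-false h (<⇒≱ j<l ∘ proj₂))
    where
    gap : ¬ Convex (suc l)
    gap convex = 1+n≰n (proj₂ (to (h (suc j) j<l)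
      (convex (m≤n⇒m≤1+n i≤j) (m<n⇒m<1+n j<l) ≤-refl
              (from (h i (≤-trans i≤j (<⇒≤ j<l))) (≤-refl , i≤j)) e)))
  ... | t , gapped 3≤t ¬convex , eq | b =
    t + χ (c l xor b) , gapped (≤-trans 3≤t (m≤m+n t _)) (¬convex ∘ Convex-pred) ,
    changes-step _ eq refl

_∈[_,_] : ∀ {n} → Fin n → ℕ → ℕ → Set
x ∈[ i , j ] = i ≤ toℕ x × toℕ x ≤ j

StrictlyBetween : ∀ {n} → Fin n → Fin n → Fin n → Set
StrictlyBetween u v x = (toℕ u < toℕ x × toℕ x < toℕ v) ⊎ (toℕ v < toℕ x × toℕ x < toℕ u)

strictlyBetween⇒≢ : ∀ {n} {u v x : Fin n} → StrictlyBetween u v x → x ≢ v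
strictlyBetween⇒≢ (inj₁ (_ , x<v)) refl = <-irrefl refl x<v
strictlyBetween⇒≢ (inj₂ (v<x , _)) refl = <-irrefl refl v<x

between-∈ : ∀ {n i j} {x y z : Fin n} →
  x ∈[ i , j ] → y ∈[ i , j ] → OnPath x y z → z ∈[ i , j ]
between-∈ (i≤x , _) (_ , y≤j) (inj₁ (x≤z , z≤y)) = ≤-trans i≤x x≤z , ≤-trans z≤y y≤j
between-∈ (_ , x≤j) (i≤y , _) (inj₂ (y≤z , z≤x)) = ≤-trans i≤y y≤z , ≤-trans z≤x x≤j

⊓-≤-split : ∀ {i i′ k} → i ⊓ i′ ≤ k → i ≤ k ⊎ i′ ≤ k
⊓-≤-split {i} {i′} h with ⊓-sel i i′
... | inj₁ eq = inj₁ (subst (_≤ _) eq h)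
... | inj₂ eq = inj₂ (subst (_≤ _) eq h)

≤-⊔-split : ∀ {j j′ k} → k ≤ j ⊔ j′ → k ≤ j ⊎ k ≤ j′
≤-⊔-split {j} {j′} h with ⊔-sel j j′
... | inj₁ eq = inj₁ (subst (_ ≤_) eq h)
... | inj₂ eq = inj₂ (subst (_ ≤_) eq h)

hull-split : ∀ {n i j i′ j′} {x z : Fin n} → z ∈[ i , j ] → z ∈[ i′ , j′ ] →
  x ∈[ i ⊓ i′ , j ⊔ j′ ] → x ∈[ i , j ] ⊎ x ∈[ i′ , j′ ]
hull-split {x = x} {z} (i≤z , z≤j) (i′≤z , z≤j′) (lo≤x , x≤hi) with toℕ x ≤? toℕ z
... | yes x≤z = Data.Sum.map (_, ≤-trans x≤z z≤j) (_, ≤-trans x≤z z≤j′) (⊓-≤-split lo≤x)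
... | no x≰z = Data.Sum.map (≤-trans i≤z z≤x ,_) (≤-trans i′≤z z≤x ,_) (≤-⊔-split x≤hi)
  where z≤x = <⇒≤ (≰⇒> x≰z)

∈-hullˡ : ∀ {n i j i′ j′} {x : Fin n} → x ∈[ i , j ] → x ∈[ i ⊓ i′ , j ⊔ j′ ]
∈-hullˡ (i≤x , x≤j) = ≤-trans (m⊓n≤m _ _) i≤x , ≤-trans x≤j (m≤m⊔n _ _)

∈-hullʳ : ∀ {n i j i′ j′} {x : Fin n} → x ∈[ i′ , j′ ] → x ∈[ i ⊓ i′ , j ⊔ j′ ]
∈-hullʳ (i≤x , x≤j) = ≤-trans (m⊓n≤n _ _) i≤x , ≤-trans x≤j (m≤n⊔m _ _)

pred[n]<n : ∀ {n} → n ≢ 0 → pred n < n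
pred[n]<n {suc n} _ = ≤-refl
pred[n]<n {zero} 0≢0 = contradiction refl 0≢0

-- Recursion on intervals [i, j] is driven by fuel k with j < i + k.

no-fuel : ∀ {i j} → j < i + 0 → ¬ i ≤ j
no-fuel {i} j<i = <⇒≱ (subst (_ <_) (+-identityʳ i) j<i)

fuel-right : ∀ {i j k b} → j < i + suc k → i ≤ b → j < suc b + k
fuel-right {i} {k = k} j<i+1+k i≤b =
  <-≤-trans j<i+1+k (≤-trans (≤-reflexive (+-suc i k)) (s≤s (+-monoˡ-≤ k i≤b)))

fuel-left : ∀ {i j k b} → j < i + suc k → i < b → b ≤ j → pred b < i + k
fuel-left {i} {j} {k} j<i+1+k i<b b≤j =
  <-≤-trans (pred[n]<n (m<n⇒n≢0 i<b))
            (≤-trans b≤j (≤-pred (subst (j <_) (+-suc i k) j<i+1+k)))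

toℕ-next : ∀ {m} (x : Fin (suc m)) → toℕ x < m → toℕ (next x) ≡ suc (toℕ x)
toℕ-next {m} x x<m with suc (toℕ x) <? suc m
... | yes p = toℕ-fromℕ< p
... | no ¬p = contradiction (s≤s x<m) ¬p

next-last : ∀ {m} (x : Fin (suc m)) → toℕ x ≡ m → next x ≡ zero
next-last {m} x x≡m with suc (toℕ x) <? suc m
... | yes p = contradiction (≤-pred p) (subst (λ k → ¬ k < m) (sym x≡m) (<-irrefl refl))
... | no _ = refl

module Cycle (m : ℕ) where

  -- toFin k is the vertex k for k ≤ m, and the junk value 0 beyond.
  toFin : ℕ → Fin (suc m)
  toFin k with k ≤? m
  ... | yes k≤m = fromℕ< (s≤s k≤m)
  ... | no _ = zero

  toFin-toℕ : ∀ x → toFin (toℕ x) ≡ x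
  toFin-toℕ x with toℕ x ≤? m
  ... | yes x≤m = fromℕ<-toℕ x (s≤s x≤m)
  ... | no x≰m = contradiction (toℕ≤pred[n] x) x≰m

  toℕ-toFin : ∀ {k} → k ≤ m → toℕ (toFin k) ≡ k
  toℕ-toFin {k} k≤m with k ≤? m
  ... | yes p = toℕ-fromℕ< (s≤s p)
  ... | no k≰m = contradiction k≤m k≰m

  next-toFin : ∀ {k} → k < m → next (toFin k) ≡ toFin (suc k)
  next-toFin {k} k<m = toℕ-injective (begin
    toℕ (next (toFin k))  ≡⟨ toℕ-next (toFin k) (subst (_< m) (sym (toℕ-toFin (<⇒≤ k<m))) k<m) ⟩
    suc (toℕ (toFin k))   ≡⟨ cong suc (toℕ-toFin (<⇒≤ k<m)) ⟩
    suc k                 ≡⟨ sym (toℕ-toFin k<m) ⟩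
    toℕ (toFin (suc k))   ∎)
    where open ≡-Reasoning

  open Transitions using (changes; Represents; none; suffix; block; gapped)

  cutSize-changes : (C : VSet (suc m)) →
    cutSize C ≡ changes (C ∘ toFin) m + χ (C (toFin m) xor C zero)
  cutSize-changes C = begin
    cutSize C
      ≡⟨ cong sum (map-tabulate id h) ⟩
    sum (tabulate h)
      ≡⟨ sum-tabulate (suc m) h (h ∘ toFin) (cong h ∘ sym ∘ toFin-toℕ) ⟩
    sumBelow (h ∘ toFin) m + h (toFin m)
      ≡⟨ cong₂ _+_ (sumBelow-cong m λ k k<m → cong (step (toFin k)) (next-toFin k<m))
                   (cong (step (toFin m)) (next-last (toFin m) (toℕ-toFin ≤-refl))) ⟩
    changes (C ∘ toFin) m + χ (C (toFin m) xor C zero)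
      ∎
    where
    open ≡-Reasoning
    step : Fin (suc m) → Fin (suc m) → ℕ
    step x y = χ (C x xor C y)
    h : Fin (suc m) → ℕ
    h x = step x (next x)

  cutSize-shape : ∀ (C : VSet (suc m)) {t b} → C zero ≡ false →
    changes (C ∘ toFin) m ≡ t → C (toFin m) ≡ b → cutSize C ≡ t + χ (b xor false)
  cutSize-shape C C0 eq Cm =
    trans (cutSize-changes C) (cong₂ _+_ eq (cong₂ (λ x y → χ (x xor y)) Cm C0))

  Proper : ℕ → ℕ → Set
  Proper i j = 1 ≤ i × i ≤ j × j ≤ m

  interval : ℕ → ℕ → VSet (suc m)
  interval i j x = ⌊ i ≤? toℕ x ×-dec toℕ x ≤? j ⌋

  interval-true : ∀ {i j} x → interval i j x ≡ true ⇔ x ∈[ i , j ]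
  interval-true x = mk⇔ (toWitness ∘ from T-≡) (to T-≡ ∘ fromWitness)

  represents⇒ : ∀ {C : VSet (suc m)} {P} → Represents (C ∘ toFin) m P →
    ∀ x → C x ≡ true ⇔ P (toℕ x)
  represents⇒ {C} {P} h x =
    subst (λ y → C y ≡ true ⇔ P (toℕ x)) (toFin-toℕ x) (h (toℕ x) (toℕ≤pred[n] x))

  ⇒represents : ∀ {C : VSet (suc m)} {P} → (∀ x → C x ≡ true ⇔ P (toℕ x)) →
    Represents (C ∘ toFin) m P
  ⇒represents {C} {P} h k k≤m =
    subst (λ l → C (toFin k) ≡ true ⇔ P l) (toℕ-toFin k≤m) (h (toFin k))

  root-bit : (C : VSet (suc m)) → C zero ≡ false → C (toFin 0) ≡ false
  root-bit C = trans (cong C (toFin-toℕ zero))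

  2cut⇒interval : ∀ {C} → Is2Cut zero C →
    ∃₂ λ i j → Proper i j × (∀ x → C x ≡ true ⇔ x ∈[ i , j ])
  2cut⇒interval {C} (C0 , two) with Transitions.shape (C ∘ toFin) (root-bit C C0) m
  ... | _ , none h , eq =
    ⊥-elim (0≢1+n (trans (sym (cutSize-shape C C0 eq (bit-false h id))) two))
    where open Transitions (C ∘ toFin) using (bit-false)
  ... | _ , suffix {i} 1≤i i≤m h , _ =
    i , m , (1≤i , i≤m , ≤-refl) ,
    λ x → mk⇔ (λ Cx → to (represents⇒ h x) Cx , toℕ≤pred[n] x) (from (represents⇒ h x) ∘ proj₁)
  ... | _ , block {i} {j} 1≤i i≤j j<m h , _ = i , j , (1≤i , i≤j , <⇒≤ j<m) , represents⇒ h
  ... | t , gapped 3≤t _ , eq =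
    ⊥-elim (1+n≰n (subst (3 ≤_) (trans (sym (cutSize-shape C C0 eq refl)) two)
                               (≤-trans 3≤t (m≤m+n t _))))

  interval-2cut : ∀ {i j} → Proper i j → Is2Cut zero (interval i j)
  interval-2cut {i} {j} (1≤i , i≤j , j≤m) = I0 , two
    where
    I = interval i j
    open Transitions (I ∘ toFin) using (Convex; shape; bit-true; bit-false)
    I0 : I zero ≡ false
    I0 = ¬-not (λ I0 → <⇒≱ 1≤i (proj₁ (to (interval-true zero) I0)))
    rep : Represents (I ∘ toFin) m (λ k → i ≤ k × k ≤ j)
    rep = ⇒represents interval-true
    convex : Convex m
    convex {k₁} {k₂} {k₃} k₁≤k₂ k₂≤k₃ k₃≤m I₁ I₃ =
      from (rep k₂ (≤-trans k₂≤k₃ k₃≤m))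
        (≤-trans (proj₁ (to (rep k₁ (≤-trans k₁≤k₂ (≤-trans k₂≤k₃ k₃≤m))) I₁)) k₁≤k₂ ,
         ≤-trans k₂≤k₃ (proj₂ (to (rep k₃ k₃≤m) I₃)))
    two : cutSize I ≡ 2
    two with shape (root-bit I I0) m
    ... | _ , none h , _ =
      ⊥-elim (to (h i (≤-trans i≤j j≤m)) (from (rep i (≤-trans i≤j j≤m)) (≤-refl , i≤j)))
    ... | _ , suffix _ i≤m h , eq = cutSize-shape I I0 eq (bit-true h i≤m)
    ... | _ , block _ _ j<m h , eq = cutSize-shape I I0 eq (bit-false h (<⇒≱ j<m ∘ proj₂))
    ... | _ , gapped _ ¬convex , _ = ⊥-elim (¬convex convex)

  Proper⇒∈[1,m] : ∀ {i j} {x : Fin (suc m)} → Proper i j → x ∈[ i , j ] → x ∈[ 1 , m ]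
  Proper⇒∈[1,m] (1≤i , _ , j≤m) (i≤x , x≤j) = ≤-trans 1≤i i≤x , ≤-trans x≤j j≤m

  hull-Proper : ∀ {i j i′ j′} → Proper i j → Proper i′ j′ → Proper (i ⊓ i′) (j ⊔ j′)
  hull-Proper (1≤i , i≤j , j≤m) (1≤i′ , i′≤j′ , j′≤m) =
    ⊓-glb 1≤i 1≤i′ , ≤-trans (m⊓n≤m _ _) (≤-trans i≤j (m≤m⊔n _ _)) , ⊔-lub j≤m j′≤m

  step-toward : ∀ {u v : Fin (suc m)} → u ≢ v →
    ∃ λ s → s ≢ u × OnPath u v s × (∀ x → StrictlyBetween u v x → OnPath s v x)
  step-toward {u} {v} u≢v with <-cmp (toℕ u) (toℕ v)
  ... | tri≈ _ u≡v _ = contradiction (toℕ-injective u≡v) u≢v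
  ... | tri< u<v _ _ =
    s , s≢u , inj₁ (subst (toℕ u ≤_) (sym ts) (n≤1+n _) , subst (_≤ toℕ v) (sym ts) u<v) ,
    onward
    where
    s = toFin (suc (toℕ u))
    ts : toℕ s ≡ suc (toℕ u)
    ts = toℕ-toFin (≤-trans u<v (toℕ≤pred[n] v))
    s≢u : s ≢ u
    s≢u s≡u = 1+n≢n (trans (sym ts) (cong toℕ s≡u))
    onward : ∀ x → StrictlyBetween u v x → OnPath s v x
    onward x (inj₁ (u<x , x<v)) = inj₁ (subst (_≤ toℕ x) (sym ts) u<x , <⇒≤ x<v)
    onward x (inj₂ (v<x , x<u)) = contradiction (<-trans v<x x<u) (<⇒≯ u<v)
  ... | tri> _ _ v<u =
    s , s≢u , inj₂ (subst (toℕ v ≤_) (sym ts) (<⇒≤pred v<u) , subst (_≤ toℕ u) (sym ts) pred[n]≤n) ,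
    onward
    where
    s = toFin (pred (toℕ u))
    ts : toℕ s ≡ pred (toℕ u)
    ts = toℕ-toFin (≤-trans pred[n]≤n (toℕ≤pred[n] u))
    s≢u : s ≢ u
    s≢u s≡u = <-irrefl (trans (sym ts) (cong toℕ s≡u)) (pred[n]<n (m<n⇒n≢0 v<u))
    onward : ∀ x → StrictlyBetween u v x → OnPath s v x
    onward x (inj₁ (u<x , x<v)) = contradiction (<-trans u<x x<v) (<⇒≯ v<u)
    onward x (inj₂ (v<x , x<u)) = inj₂ (<⇒≤ v<x , subst (toℕ x ≤_) (sym ts) (<⇒≤pred x<u))

module Walks {n} (F : DLinkSet n) where

  infixr 5 _++ʷ_
  _++ʷ_ : ∀ {x y z} → Walk F x y → Walk F y z → Walk F x z
  [] ++ʷ q = q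
  (e ∷ p) ++ʷ q = e ∷ (p ++ʷ q)

  linkOn-++ʷ : ∀ {x y z a b} (p : Walk F x y) (q : Walk F y z) →
    LinkOn a b p → LinkOn a b (p ++ʷ q)
  linkOn-++ʷ (e ∷ p) q (inj₁ ab) = inj₁ ab
  linkOn-++ʷ (e ∷ p) q (inj₂ ab∈p) = inj₂ (linkOn-++ʷ p q ab∈p)

  walk-after : ∀ {x y a b} (p : Walk F x y) → LinkOn a b p → Walk F b y
  walk-after (e ∷ p) (inj₁ (refl , refl)) = p
  walk-after (e ∷ p) (inj₂ ab∈p) = walk-after p ab∈p

  covering-link : (C : VSet n) → ∀ {x y} (p : Walk F x y) → C x ≡ false → C y ≡ true →
    ∃₂ λ a b → LinkOn a b p × Covers a b C
  covering-link C [] Cx Cy = contradiction (trans (sym Cy) Cx) λ ()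
  covering-link C {x} (_∷_ {y = x′} e p) Cx Cy with C x′ in Cx′
  ... | true = x , x′ , inj₁ (refl , refl) , Cx′ , Cx
  ... | false with covering-link C p Cx′ Cy
  ...   | a , b , ab∈p , cov = a , b , inj₂ ab∈p , cov

  last-link : ∀ {x y} → Walk F x y → x ≢ y → ∃ λ a → Walk F x a × (a , y) ∈F F
  last-link [] x≢y = contradiction refl x≢y
  last-link {x} {y} (_∷_ {y = x′} e p) x≢y with x′ ≟ y
  ... | yes refl = x , [] , e
  ... | no x′≢y with last-link p x′≢y
  ...   | a , q , ay = a , e ∷ q , ay

  _∈ʷ_ : ∀ {x y} → Fin n → Walk F x y → Set
  _∈ʷ_ {x} z [] = z ≡ x
  _∈ʷ_ {x} z (e ∷ p) = z ≡ x ⊎ z ∈ʷ p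

  end-∈ʷ : ∀ {x y} (p : Walk F x y) → y ∈ʷ p
  end-∈ʷ [] = refl
  end-∈ʷ (e ∷ p) = inj₂ (end-∈ʷ p)

  start-∈ʷ : ∀ {x y} (p : Walk F x y) → x ∈ʷ p
  start-∈ʷ [] = refl
  start-∈ʷ (e ∷ p) = inj₁ refl

  ∈ʷ-predecessor : ∀ {x y z} (p : Walk F x y) → z ∈ʷ p →
    z ≡ x ⊎ ∃ λ w → (w , z) ∈F F × w ∈ʷ p
  ∈ʷ-predecessor [] z≡x = inj₁ z≡x
  ∈ʷ-predecessor (e ∷ p) (inj₁ z≡x) = inj₁ z≡x
  ∈ʷ-predecessor {x} (e ∷ p) (inj₂ z∈p) with ∈ʷ-predecessor p z∈p
  ... | inj₁ refl = inj₂ (x , e , inj₁ refl)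
  ... | inj₂ (w , wz , w∈p) = inj₂ (w , wz , inj₂ w∈p)

  module _ (in-unique : ∀ {a a′ y} → (a , y) ∈F F → (a′ , y) ∈F F → a ≡ a′) where

    backward-closed : (P : Fin n → Set) → (∀ {y} → P y → ∃ λ w → (w , y) ∈F F × P w) →
      ∀ {x y} → Walk F x y → P y → P x
    backward-closed P has-pred [] Py = Py
    backward-closed P has-pred (e ∷ p) Py with has-pred (backward-closed P has-pred p Py)
    ... | w , f , Pw = subst P (in-unique f e) Pw

    cycle-ancestor-has-in-link : ∀ {u v} → (u , v) ∈F F → (p : Walk F v u) →
      ∀ {r} → Walk F r v → ∃ λ w → (w , r) ∈F F
    cycle-ancestor-has-in-link {u} uv p rv = map₂ proj₁ ancestor-pred
      where
      pred-on-cycle : ∀ {y} → y ∈ʷ p → ∃ λ w → (w , y) ∈F F × w ∈ʷ p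
      pred-on-cycle y∈p with ∈ʷ-predecessor p y∈p
      ... | inj₁ refl = u , uv , end-∈ʷ p
      ... | inj₂ w = w
      ancestor-pred = pred-on-cycle (backward-closed (_∈ʷ p) pred-on-cycle rv (start-∈ʷ p))

module _ {n} (F : DLinkSet n) where

  remove-keeps : ∀ {u v x y} → (x , y) ∈F F → ¬ (x ≡ u × y ≡ v) → (x , y) ∈F remove F u v
  remove-keeps {u} {v} {x} {y} xy xy≢uv with x ≟ u | y ≟ v
  ... | yes refl | yes refl = contradiction (refl , refl) xy≢uv
  ... | yes _ | no _ = xy
  ... | no _ | _ = xy

  add-keeps : ∀ s v {x y} → (x , y) ∈F F → (x , y) ∈F add F s v
  add-keeps s v {x} {y} xy with x ≟ s | y ≟ v
  ... | yes _ | yes _ = refl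
  ... | yes _ | no _ = xy
  ... | no _ | _ = xy

  add-adds : ∀ s v → (s , v) ∈F add F s v
  add-adds s v with s ≟ s | v ≟ v
  ... | yes _ | yes _ = refl
  ... | yes _ | no v≢v = contradiction refl v≢v
  ... | no s≢s | _ = contradiction refl s≢s

module NonShortenableStructure (m : ℕ) (1≤m : 1 ≤ m) (F : DLinkSet (suc m))
  (feasible : Feasible zero F)
  (removal-breaks : ∀ u v → (u , v) ∈F F → ¬ Feasible zero (remove F u v))
  (shortening-breaks : ∀ u v → (u , v) ∈F F → ∀ s → StrictShortening u v s →
                       ¬ Feasible zero (add (remove F u v) s v)) where

  open Cycle m
  open Walks F

  V : Set
  V = Fin (suc m)

  EntersIn : DLinkSet (suc m) → V → V → ℕ → ℕ → Set
  EntersIn G x y i j = (x , y) ∈F G × y ∈[ i , j ] × ¬ x ∈[ i , j ]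

  Enters : V → V → ℕ → ℕ → Set
  Enters = EntersIn F

  EnteredBesides : V → V → ℕ → ℕ → Set
  EnteredBesides u v i j = ∃₂ λ x y → Enters x y i j × ¬ (x ≡ u × y ≡ v)

  SoleEntry : V → V → ℕ → ℕ → Set
  SoleEntry u v i j = Enters u v i j × ¬ EnteredBesides u v i j

  module _ {u v i j} (sole : SoleEntry u v i j) where

    sole-link : (u , v) ∈F F
    sole-link = proj₁ (proj₁ sole)

    sole-head : v ∈[ i , j ]
    sole-head = proj₁ (proj₂ (proj₁ sole))

    sole-tail : ¬ u ∈[ i , j ]
    sole-tail = proj₂ (proj₂ (proj₁ sole))

  ∈[]? : ∀ i j (x : V) → Dec (x ∈[ i , j ])
  ∈[]? i j x = i ≤? toℕ x ×-dec toℕ x ≤? j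

  proper? : ∀ i j → Dec (Proper i j)
  proper? i j = 1 ≤? i ×-dec i ≤? j ×-dec j ≤? m

  enters? : ∀ x y i j → Dec (Enters x y i j)
  enters? x y i j = F x y ≟ᵇ true ×-dec ∈[]? i j y ×-dec ¬? (∈[]? i j x)

  enteredBesides? : ∀ u v i j → Dec (EnteredBesides u v i j)
  enteredBesides? u v i j =
    any? λ x → any? λ y → enters? x y i j ×-dec ¬? (x ≟ u ×-dec y ≟ v)

  soleEntry? : ∀ u v i j → Dec (SoleEntry u v i j)
  soleEntry? u v i j = enters? u v i j ×-dec ¬? (enteredBesides? u v i j)

  sole-entry-unique : ∀ {u v x y i j} → SoleEntry u v i j → Enters x y i j → x ≡ u × y ≡ v
  sole-entry-unique {u} {v} {x} {y} (_ , no-other) e =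
    decidable-stable (x ≟ u ×-dec y ≟ v) (λ xy≢uv → no-other (x , y , e , xy≢uv))

  entered : ∀ {i j} → Proper i j → ∃₂ λ x y → Enters x y i j
  entered ij with feasible (interval _ _) (interval-2cut ij)
  ... | x , y , xy , Iy , Ix = x , y , xy , to (interval-true y) Iy , false⇒¬ (interval-true x) Ix

  feasible-after-replacing : ∀ {u v} (G : DLinkSet (suc m)) →
    (∀ {x y} → (x , y) ∈F F → ¬ (x ≡ u × y ≡ v) → (x , y) ∈F G) →
    (∀ {i j} → Proper i j → Enters u v i j → ∃₂ λ x y → EntersIn G x y i j) →
    Feasible zero G
  feasible-after-replacing {u} {v} G keeps replaced D cut with 2cut⇒interval cut | feasible D cut
  ... | i , j , ij , D⇔ | a , b , ab , Db , Da with a ≟ u ×-dec b ≟ v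
  ...   | no ab≢uv = a , b , keeps ab ab≢uv , Db , Da
  ...   | yes (refl , refl) with replaced ij (ab , to (D⇔ b) Db , false⇒¬ (D⇔ a) Da)
  ...     | x , y , xy , y∈ , x∉ = x , y , xy , from (D⇔ y) y∈ , ¬⇒false (D⇔ x) x∉

  feasible-after-removal : ∀ {u v} →
    (∀ {i j} → Proper i j → Enters u v i j → EnteredBesides u v i j) →
    Feasible zero (remove F u v)
  feasible-after-removal besides = feasible-after-replacing _ (remove-keeps F) λ ij e →
    let x , y , (xy , y∈ , x∉) , xy≢uv = besides ij e
    in  x , y , remove-keeps F xy xy≢uv , y∈ , x∉

  feasible-after-shortening : ∀ {u v} s →
    (∀ {i j} → Proper i j → Enters u v i j → s ∈[ i , j ] → EnteredBesides u v i j) →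
    Feasible zero (add (remove F u v) s v)
  feasible-after-shortening {u} {v} s besides = feasible-after-replacing _ keeps replaced
    where
    G = add (remove F u v) s v
    keeps : ∀ {x y} → (x , y) ∈F F → ¬ (x ≡ u × y ≡ v) → (x , y) ∈F G
    keeps xy xy≢uv = add-keeps (remove F u v) s v (remove-keeps F xy xy≢uv)
    replaced : ∀ {i j} → Proper i j → Enters u v i j → ∃₂ λ x y → EntersIn G x y i j
    replaced {i} {j} ij e@(_ , v∈ , _) with ∈[]? i j s
    ... | no s∉ = s , v , add-adds (remove F u v) s v , v∈ , s∉
    ... | yes s∈ with besides ij e s∈
    ...   | x , y , (xy , y∈ , x∉) , xy≢uv = x , y , keeps xy xy≢uv , y∈ , x∉

  no-loop : ∀ {u} → (u , u) ∈F F → ⊥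
  no-loop uu = removal-breaks _ _ uu
    (feasible-after-removal λ _ (_ , u∈ , u∉) → contradiction u∈ u∉)

  no-link-into-root : ∀ {a} → (a , zero) ∈F F → ⊥
  no-link-into-root a0 = removal-breaks _ _ a0 (feasible-after-removal
    λ (1≤i , _) (_ , (i≤0 , _) , _) → contradiction (≤-trans 1≤i i≤0) λ ())

  Window : V → V → Set
  Window u v = ∃₂ λ i j →
    Proper i j × SoleEntry u v i j × (∀ x → StrictlyBetween u v x → x ∈[ i , j ])

  -- Let s be the neighbour of u towards v.  If no interval containing s were
  -- entered by (u, v) alone, the shortening (s, v) — or the deletion of
  -- (u, v), when s = v — would keep F feasible.
  window : ∀ {u v} → (u , v) ∈F F → Window u v
  window {u} {v} uv
    with step-toward {u} {v} (λ u≡v → no-loop (subst (λ w → (u , w) ∈F F) (sym u≡v) uv))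
  ... | s , s≢u , s-on-path , s-first
    with any? (λ k → any? (λ l → let i = toℕ k ; j = toℕ l in
                               proper? i j ×-dec ∈[]? i j s ×-dec soleEntry? u v i j))
  ...   | yes (k , l , kl , s∈ , sole@((_ , v∈ , _) , _)) =
    toℕ k , toℕ l , kl , sole , λ x x-strict → between-∈ s∈ v∈ (s-first x x-strict)
  ...   | no no-window = ⊥-elim impossible
    where
    besides : ∀ {i j} → Proper i j → Enters u v i j → s ∈[ i , j ] → EnteredBesides u v i j
    besides {i} {j} ij@(_ , i≤j , j≤m) e s∈ =
      decidable-stable (enteredBesides? u v i j) λ alone → no-window (toFin i , toFin j ,
        subst₂ (λ i′ j′ → Proper i′ j′ × s ∈[ i′ , j′ ] × SoleEntry u v i′ j′)
               (sym (toℕ-toFin (≤-trans i≤j j≤m))) (sym (toℕ-toFin j≤m)) (ij , s∈ , e , alone))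
    impossible : ⊥
    impossible with s ≟ v
    ... | yes refl =
      removal-breaks u v uv (feasible-after-removal λ ij e@(_ , v∈ , _) → besides ij e v∈)
    ... | no s≢v =
      shortening-breaks u v uv s ((s≢v , s-on-path) , s≢u) (feasible-after-shortening s besides)

  -- Crossing sole entries would leave the union of the two intervals unentered.
  no-crossing : ∀ {i j i′ j′ a b a′ b′} {z : V} → Proper i j → SoleEntry a b i j →
    Proper i′ j′ → SoleEntry a′ b′ i′ j′ → z ∈[ i , j ] → z ∈[ i′ , j′ ] →
    a ∈[ i′ , j′ ] → a′ ∈[ i , j ] → ⊥
  no-crossing ij sole i′j′ sole′ z∈ z∈′ a∈′ a′∈ with entered (hull-Proper ij i′j′)
  ... | x , y , xy , y∈ , x∉ with hull-split z∈ z∈′ y∈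
  ...   | inj₁ y∈I = x∉ (∈-hullʳ (subst (_∈[ _ , _ ])
            (sym (proj₁ (sole-entry-unique sole (xy , y∈I , x∉ ∘ ∈-hullˡ)))) a∈′))
  ...   | inj₂ y∈I′ = x∉ (∈-hullˡ (subst (_∈[ _ , _ ])
            (sym (proj₁ (sole-entry-unique sole′ (xy , y∈I′ , x∉ ∘ ∈-hullʳ)))) a′∈))

  in-link-unique : ∀ {a a′ v} → (a , v) ∈F F → (a′ , v) ∈F F → a ≡ a′
  in-link-unique {a} {a′} {v} av a′v with window av | window a′v
  ... | i , j , ij , sole , _ | i′ , j′ , i′j′ , sole′ , _
    with ∈[]? i′ j′ a | ∈[]? i j a′
  ...   | no a∉′ | _ = proj₁ (sole-entry-unique sole′ (av , sole-head sole′ , a∉′))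
  ...   | yes _ | no a′∉ = sym (proj₁ (sole-entry-unique sole (a′v , sole-head sole , a′∉)))
  ...   | yes a∈′ | yes a′∈ =
    ⊥-elim (no-crossing ij sole i′j′ sole′ (sole-head sole) (sole-head sole′) a∈′ a′∈)

  no-jump : ∀ {i j a b x y} → Proper i j → SoleEntry a b i j → x ∈[ i , j ] →
    StrictlyBetween x y b → (x , y) ∈F F → ⊥
  no-jump {i} {j} {a} {b} ij sole x∈ b-between xy with window xy
  ... | i′ , j′ , i′j′ , sole′ , between⊆ with ∈[]? i′ j′ a
  ...   | no a∉′ = strictlyBetween⇒≢ b-between
                     (proj₂ (sole-entry-unique sole′ (sole-link sole , between⊆ b b-between , a∉′)))
  ...   | yes a∈′ = no-crossing ij sole i′j′ sole′ (sole-head sole) (between⊆ b b-between) a∈′ x∈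

  nearer-out-link : ∀ {b c d} → (b , c) ∈F F → (b , d) ∈F F → StrictlyBetween b c d → d ≡ c
  nearer-out-link bc bd d-between with window bc
  ... | i , j , _ , sole , between⊆ =
    proj₂ (sole-entry-unique sole (bd , between⊆ _ d-between , sole-tail sole))

  SameSide : V → V → V → Set
  SameSide b c c′ = (toℕ b < toℕ c × toℕ b < toℕ c′) ⊎ (toℕ c < toℕ b × toℕ c′ < toℕ b)

  out-link-unique : ∀ {b c c′} → (b , c) ∈F F → (b , c′) ∈F F → SameSide b c c′ → c ≡ c′
  out-link-unique {b} {c} {c′} bc bc′ side with <-cmp (toℕ c) (toℕ c′) | side
  ... | tri≈ _ c≡c′ _ | _ = toℕ-injective c≡c′
  ... | tri< c<c′ _ _ | inj₁ (b<c , _) = nearer-out-link bc′ bc (inj₁ (b<c , c<c′))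
  ... | tri< c<c′ _ _ | inj₂ (_ , c′<b) = sym (nearer-out-link bc bc′ (inj₂ (c<c′ , c′<b)))
  ... | tri> _ _ c′<c | inj₁ (_ , b<c′) = sym (nearer-out-link bc bc′ (inj₁ (b<c′ , c′<c)))
  ... | tri> _ _ c′<c | inj₂ (c<b , _) = nearer-out-link bc′ bc (inj₂ (c′<c , c<b))

  sole-entry-from : ∀ {b i j} → Proper i j → toℕ b < i ⊎ j < toℕ b →
    (∀ {x y} → Enters x y i j → x ≡ b) → ∃ λ c → SoleEntry b c i j
  sole-entry-from {b} {i} {j} ij side from-b with entered ij
  ... | x , y , e@(by , y∈ , _) with from-b e
  ...   | refl = y , e , alone
    where
    same-side : ∀ {c c′ : V} → toℕ b < i ⊎ j < toℕ b →
      c ∈[ i , j ] → c′ ∈[ i , j ] → SameSide b c c′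
    same-side (inj₁ b<i) (i≤c , _) (i≤c′ , _) = inj₁ (<-≤-trans b<i i≤c , <-≤-trans b<i i≤c′)
    same-side (inj₂ j<b) (_ , c≤j) (_ , c′≤j) = inj₂ (≤-<-trans c≤j j<b , ≤-<-trans c′≤j j<b)
    alone : ¬ EnteredBesides b y i j
    alone (x′ , y′ , e′@(x′y′ , y′∈ , _) , ne) with from-b e′
    ... | refl = ne (refl , out-link-unique x′y′ by (same-side side y′∈ y∈))

  entry-inside : ∀ {a b i j i′ j′ x y} → SoleEntry a b i j →
    (∀ {z : V} → z ∈[ i′ , j′ ] → z ∈[ i , j ]) → ¬ b ∈[ i′ , j′ ] →
    Enters x y i′ j′ → x ∈[ i , j ]
  entry-inside {i = i} {j} {x = x} sole ⊆I b∉ (xy , y∈ , _) =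
    decidable-stable (∈[]? i j x) λ x∉ → b∉ (subst (_∈[ _ , _ ]) (proj₂ (sole-entry-unique sole (xy , ⊆I y∈ , x∉))) y∈)

  right-part : ∀ {i j a b} → Proper i j → SoleEntry a b i j → toℕ b < j →
    ∃ λ c → Proper (suc (toℕ b)) j × SoleEntry b c (suc (toℕ b)) j
  right-part {i} {j} {b = b} ij@(_ , _ , j≤m) sole b<j =
    map₂ (proper ,_) (sole-entry-from proper (inj₁ ≤-refl) from-b)
    where
    proper : Proper (suc (toℕ b)) j
    proper = s≤s z≤n , b<j , j≤m
    inner : ∀ {z : V} → z ∈[ suc (toℕ b) , j ] → z ∈[ i , j ]
    inner (b<z , z≤j) = ≤-trans (proj₁ (sole-head sole)) (<⇒≤ b<z) , z≤j
    from-b : ∀ {x y} → Enters x y (suc (toℕ b)) j → x ≡ b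
    from-b {x} e@(xy , (b<y , _) , x∉)
      with <-cmp (toℕ x) (toℕ b) | entry-inside sole inner (λ (b<b , _) → 1+n≰n b<b) e
    ... | tri≈ _ x≡b _ | _ = toℕ-injective x≡b
    ... | tri< x<b _ _ | x∈ = ⊥-elim (no-jump ij sole x∈ (inj₁ (x<b , b<y)) xy)
    ... | tri> _ _ b<x | (_ , x≤j) = ⊥-elim (x∉ (b<x , x≤j))

  left-part : ∀ {i j a b} → Proper i j → SoleEntry a b i j → i < toℕ b →
    ∃ λ c → Proper i (pred (toℕ b)) × SoleEntry b c i (pred (toℕ b))
  left-part {i} {j} {b = b} ij@(1≤i , _ , j≤m) sole i<b =
    map₂ (proper ,_) (sole-entry-from proper (inj₂ pred-b<b) from-b)
    where
    b≤j = proj₂ (sole-head sole)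
    pred-b<b : pred (toℕ b) < toℕ b
    pred-b<b = pred[n]<n (m<n⇒n≢0 i<b)
    proper : Proper i (pred (toℕ b))
    proper = 1≤i , <⇒≤pred i<b , ≤-trans pred[n]≤n (≤-trans b≤j j≤m)
    inner : ∀ {z : V} → z ∈[ i , pred (toℕ b) ] → z ∈[ i , j ]
    inner (i≤z , z≤b-1) = i≤z , ≤-trans z≤b-1 (≤-trans pred[n]≤n b≤j)
    from-b : ∀ {x y} → Enters x y i (pred (toℕ b)) → x ≡ b
    from-b {x} e@(xy , (_ , y≤b-1) , x∉)
      with <-cmp (toℕ x) (toℕ b) | entry-inside sole inner (λ (_ , b≤b-1) → <⇒≱ pred-b<b b≤b-1) e
    ... | tri≈ _ x≡b _ | _ = toℕ-injective x≡b
    ... | tri< x<b _ _ | (i≤x , _) = ⊥-elim (x∉ (i≤x , <⇒≤pred x<b))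
    ... | tri> _ _ b<x | x∈ = ⊥-elim (no-jump ij sole x∈ (inj₂ (≤-<-trans y≤b-1 pred-b<b , b<x)) xy)

  reaches : ∀ k {i j a b} → j < i + k → Proper i j → SoleEntry a b i j →
    ∀ {x} → x ∈[ i , j ] → Walk F b x
  reaches zero fuel (_ , i≤j , _) _ _ = contradiction i≤j (no-fuel fuel)
  reaches (suc k) {b = b} fuel ij sole {x} (i≤x , x≤j) with <-cmp (toℕ x) (toℕ b)
  ... | tri≈ _ x≡b _ = subst (Walk F b) (toℕ-injective (sym x≡b)) []
  ... | tri< x<b _ _ =
    let _ , proper , sole′ = left-part ij sole (≤-<-trans i≤x x<b) in
    sole-link sole′ ∷ reaches k (fuel-left fuel (≤-<-trans i≤x x<b) (proj₂ (sole-head sole)))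
                                proper sole′ (i≤x , <⇒≤pred x<b)
  ... | tri> _ _ b<x =
    let _ , proper , sole′ = right-part ij sole (<-≤-trans b<x x≤j) in
    sole-link sole′ ∷ reaches k (fuel-right fuel (proj₁ (sole-head sole)))
                                proper sole′ (b<x , x≤j)

  ReachOrReturn : V → V → Set
  ReachOrReturn x y = Walk F x y ⊎ ∃ λ z → OnPath x y z × z ≢ x × Walk F z x

  reach-or-return : ∀ k {i j a b} → j < i + k → Proper i j → SoleEntry a b i j →
    ∀ {x y} → x ∈[ i , j ] → y ∈[ i , j ] → ReachOrReturn x y
  reach-or-return zero fuel (_ , i≤j , _) _ _ _ = contradiction i≤j (no-fuel fuel)
  reach-or-return (suc k) {b = b} fuel ij sole {x} {y} x∈@(i≤x , x≤j) y∈@(i≤y , y≤j) =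
    compare (<-cmp (toℕ x) (toℕ b)) (<-cmp (toℕ y) (toℕ b))
    where
    via-b : toℕ x ≢ toℕ b → OnPath x y b → ReachOrReturn x y
    via-b x≢b b-on-path =
      inj₂ (b , b-on-path , x≢b ∘ cong toℕ ∘ sym , reaches (suc k) fuel ij sole x∈)
    compare : Tri (toℕ x < toℕ b) (toℕ x ≡ toℕ b) (toℕ x > toℕ b) →
              Tri (toℕ y < toℕ b) (toℕ y ≡ toℕ b) (toℕ y > toℕ b) → ReachOrReturn x y
    compare (tri≈ _ x≡b _) _ =
      inj₁ (subst (λ w → Walk F w y) (toℕ-injective (sym x≡b)) (reaches (suc k) fuel ij sole y∈))
    compare (tri< x<b x≢b _) (tri≈ _ y≡b _) = via-b x≢b (inj₁ (<⇒≤ x<b , ≤-reflexive (sym y≡b)))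
    compare (tri< x<b x≢b _) (tri> _ _ b<y) = via-b x≢b (inj₁ (<⇒≤ x<b , <⇒≤ b<y))
    compare (tri> _ x≢b b<x) (tri≈ _ y≡b _) = via-b x≢b (inj₂ (≤-reflexive y≡b , <⇒≤ b<x))
    compare (tri> _ x≢b b<x) (tri< y<b _ _) = via-b x≢b (inj₂ (<⇒≤ y<b , <⇒≤ b<x))
    compare (tri< x<b _ _) (tri< y<b _ _) =
      let _ , proper , sole′ = left-part ij sole (≤-<-trans i≤x x<b) in
      reach-or-return k (fuel-left fuel (≤-<-trans i≤x x<b) (proj₂ (sole-head sole))) proper sole′
                      (i≤x , <⇒≤pred x<b) (i≤y , <⇒≤pred y<b)
    compare (tri> _ _ b<x) (tri> _ _ b<y) =
      let _ , proper , sole′ = right-part ij sole (<-≤-trans b<x x≤j) in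
      reach-or-return k (fuel-right fuel (proj₁ (sole-head sole))) proper sole′
                      (b<x , x≤j) (b<y , y≤j)

  root-proper : Proper 1 m
  root-proper = ≤-refl , 1≤m , ≤-refl

  root-window : ∃ λ c → SoleEntry zero c 1 m
  root-window = sole-entry-from root-proper (inj₁ ≤-refl) from-root
    where
    from-root : ∀ {x y} → Enters x y 1 m → x ≡ zero
    from-root {zero} _ = refl
    from-root {suc x} (_ , _ , x∉) = ⊥-elim (x∉ (s≤s z≤n , toℕ≤pred[n] (suc x)))

  reach-all : ∀ w → Walk F zero w
  reach-all zero = []
  reach-all (suc w) =
    sole-link (proj₂ root-window) ∷
    reaches m ≤-refl root-proper (proj₂ root-window) (s≤s z≤n , toℕ≤pred[n] (suc w))

  acyclic : ∀ {u v} → (u , v) ∈F F → ¬ Walk F v u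
  acyclic uv vu =
    no-link-into-root (proj₂ (cycle-ancestor-has-in-link in-link-unique uv vu (reach-all _)))

  covered-above : ∀ {u v z} {C : VSet (suc m)} → (u , v) ∈F F → C zero ≡ false → C z ≡ true →
    z ≢ v → Walk F z v → ∃ λ (p : Walk F zero u) → ∃₂ λ a b → LinkOn a b p × Covers a b C
  covered-above {C = C} uv C0 Cz z≢v zv with last-link zv z≢v
  ... | a , za , av with covering-link C (reach-all _) C0 Cz
  ...   | x , y , xy∈ , covers =
    reach-all _ ++ʷ subst (Walk F _) (in-link-unique av uv) za , x , y , linkOn-++ʷ _ _ xy∈ , covers

  descendants⇒responsible : ∀ {u v} {C : VSet (suc m)} → (u , v) ∈F F →
    C v ≡ true → (∀ w → C w ≡ true → Walk F v w) → Responsible zero F u v C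
  descendants⇒responsible uv Cv descendant =
    (Cv , ¬-not (λ Cu → acyclic uv (descendant _ Cu))) ,
    λ p a b ab∈p (Cb , _) → acyclic uv (descendant b Cb ++ʷ walk-after p ab∈p)

  responsible⇒descendants : ∀ {u v} {C : VSet (suc m)} → (u , v) ∈F F → Is2Cut zero C →
    Responsible zero F u v C → ∀ w → C w ≡ true → Walk F v w
  responsible⇒descendants {u} {v} {C} uv cut ((Cv , _) , first) w Cw with 2cut⇒interval cut
  ... | _ , _ , ij , C⇔
    with reach-or-return m ≤-refl root-proper (proj₂ root-window)
           (Proper⇒∈[1,m] ij (to (C⇔ v) Cv)) (Proper⇒∈[1,m] ij (to (C⇔ w) Cw))
  ...   | inj₁ vw = vw
  ...   | inj₂ (z , z-between , z≢v , zv) =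
    let Cz = from (C⇔ z) (between-∈ (to (C⇔ v) Cv) (to (C⇔ w) Cw) z-between)
        p , a , b , ab∈p , covers = covered-above {C = C} uv (proj₁ cut) Cz z≢v zv
    in  ⊥-elim (first p a b ab∈p covers)

lemma30 : (n : ℕ) → 3 ≤ n → (r : Fin n) → toℕ r ≡ 0 →
    (L : LinkSet n) → (c : Fin n → Fin n → ℕ) →
    (∀ u v → L u v ≡ true → u ≢ v) →
    (F : DLinkSet n) → (∀ a b → (a , b) ∈F F → Shadow L a b) →
    NonShortenable r F →
    ∀ u v → (u , v) ∈F F → (C : VSet n) → Is2Cut r C →
    Responsible r F u v C ⇔ ((C v ≡ true) × (∀ w → C w ≡ true → Bad F v w))
lemma30 zero _ () _
lemma30 (suc m) _ (suc r) ()
lemma30 (suc m) 3≤n zero refl _ _ _ F _ (feasible , critical) u v uv C cut =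
  mk⇔ (λ responsible → proj₁ (proj₁ responsible) , responsible⇒descendants uv cut responsible)
      (λ (Cv , descendant) → descendants⇒responsible uv Cv descendant)
  where
  open NonShortenableStructure m (≤-pred (≤-trans (n≤1+n 2) 3≤n)) F feasible
    (λ u v uv → proj₁ (critical u v uv)) (λ u v uv → proj₂ (critical u v uv))
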